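{- For every set $\Gamma$ of formulas of $\mathcal{L}_{\mathsf{MBCL}}$ and every formula $A$: if $\Gamma\vdash_{Ax_{\mathsf{MBCL}}^{\mathsf{CUDL}}}A$, then $\Gamma\vDash_{\mathbf{F}^{dL}}A$.
   Context: $\mathcal{L}_{\mathsf{MBCL}}$ has variables $p_0,p_1,\dots$ (set $\mathrm{Var}$), unary $\neg,\Box,\Diamond$, binary $\wedge,\vee,\rightarrow$; $\mathrm{For}$ its formulas. $A\supset B:=\neg A\vee B$, $A\equiv B:=(\neg A\vee B)\wedge(\neg B\vee A)$. The demodalization $d:\mathrm{For}\to\mathrm{For}$ is defined by $d(p)=p$ for variables, $d(\neg A)=\neg d(A)$, $d(A\star B)=d(A)\star d(B)$ for $\star\in\{\wedge,\vee,\rightarrow\}$, $d(\Box A)=d(\Diamond A)=d(A)$. A model is $\langle W,Q,\{R_w\}_{w\in W},v\rangle$ with $W\neq\emptyset$, $Q\subseteq W\times W$, $R_w\subseteq\mathrm{For}\times\mathrm{For}$, $v:W\times\mathrm{Var}\to\{0,1\}$; $\langle W,Q,\{R_w\}\rangle$ is its frame. Truth at $w$: $p$ iff $v(w,p)=1$; $\neg,\wedge,\vee$ classical; $\Box B$ iff $B$ true at every $Q$-successor of $w$; $\Diamond B$ iff $B$ true at some $Q$-successor; $B\rightarrow C$ iff ($B$ false at $w$ or $C$ true at $w$) and $R_w(B,C)$. Conditions on a relation $R$ (for all $A,B$): (a1) not $R(A,\neg A)$; (a2) not $R(\neg A,A)$; (b0) $R(A,B)\Rightarrow$ not $R(A,\neg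 B)$; (b1) $R(A\rightarrow B,\neg(A\rightarrow\neg B))$; (b2) $R(A\rightarrow\neg B,\neg(A\rightarrow B))$; (demL) $R(d(A),d(B))\Rightarrow R(A,B)$. $\mathbf{F}^{dL}$: frames in which every $R_w$ satisfies (a1),(a2),(b0),(b1),(b2),(demL). $\Gamma\vDash_{\mathbf{F}^{dL}}A$: for every model on a frame in the class and every world $w$, if all of $\Gamma$ true at $w$ then $A$ true at $w$. $Ax_{\mathsf{MBCL}}^{\mathsf{CUDL}}$ has axiom schemata: (CPL) substitution instances of classical tautologies; $\neg(A\rightarrow\neg A)$; $\neg(\neg A\rightarrow A)$; $(A\rightarrow B)\rightarrow\neg(A\rightarrow\neg B)$; $(A\rightarrow\neg B)\rightarrow\neg(A\rightarrow B)$; $(A\rightarrow B)\supset(A\supset B)$; (Dual) $\Diamond A\equiv\neg\Box\neg A$; (K$^\supset$) $\Box(A\supset B)\supset(\Box A\supset\Box B)$; (CUDL) $(d(A)\rightarrow d(B))\supset((A\rightarrow B)\vee(A\wedge\neg B))$; rules: from $A$ and $A\supset B$ infer $B$; from a theorem $A$ infer $\Box A$. $\Gamma\vdash A$: $A$ derivable from theorems and members of $\Gamma$ using the first rule. -}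

module Defs where

open import Data.Nat using (ℕ)
open import Data.Bool using (Bool; true; false; not; _∧_; _∨_)
open import Data.Product using (Σ; _×_; _,_)
open import Data.Sum using (_⊎_)
open import Relation.Nullary using (¬_)
open import Relation.Binary.PropositionalEquality using (_≡_)

infixr 6 _∧'_
infixr 5 _∨'_
infixr 4 _⇒_

data For : Set where
  var  : ℕ → For
  ¬'_  : For → For
  □_   : For → For
  ◇_   : For → For
  _∧'_ : For → For → For
  _∨'_ : For → For → For
  _⇒_  : For → For → For

_⊃_ : For → For → For
A ⊃ B = (¬' A) ∨' B

_≣_ : For → For → For
A ≣ B = ((¬' A) ∨' B) ∧' ((¬' B) ∨' A)

d : For → For
d (var p)  = var p
d (¬' A)   = ¬' d A
d (□ A)    = d A
d (◇ A)    = d A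
d (A ∧' B) = d A ∧' d B
d (A ∨' B) = d A ∨' d B
d (A ⇒ B)  = d A ⇒ d B

record Frame : Set₁ where
  field
    W : Set
    inhabited : W
    Q : W → W → Set
    R : W → For → For → Set

record Model : Set₁ where
  field
    frame : Frame
  open Frame frame public
  field
    v : W → ℕ → Bool

module _ (M : Model) where
  open Model M

  Sat : W → For → Set
  Sat w (var p)  = v w p ≡ true
  Sat w (¬' A)   = ¬ Sat w A
  Sat w (□ A)    = ∀ u → Q w u → Sat u A
  Sat w (◇ A)    = Σ W (λ u → Q w u × Sat u A)
  Sat w (A ∧' B) = Sat w A × Sat w B
  Sat w (A ∨' B) = Sat w A ⊎ Sat w B
  Sat w (A ⇒ B)  = ((¬ Sat w A) ⊎ Sat w B) × R w A B

record Conditions (R : For → For → Set) : Set where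
  field
    a1   : ∀ A → ¬ R A (¬' A)
    a2   : ∀ A → ¬ R (¬' A) A
    b0   : ∀ A B → R A B → ¬ R A (¬' B)
    b1   : ∀ A B → R (A ⇒ B) (¬' (A ⇒ ¬' B))
    b2   : ∀ A B → R (A ⇒ ¬' B) (¬' (A ⇒ B))
    demL : ∀ A B → R (d A) (d B) → R A B

InFdL : Frame → Set
InFdL F = ∀ w → Conditions (Frame.R F w)

_⊨dL_ : (For → Set) → For → Set₁
Γ ⊨dL A = (M : Model) → InFdL (Model.frame M) → (w : Model.W M) →
          (∀ B → Γ B → Sat M w B) → Sat M w A

-- Classical tautologies: propositional formulas over ¬, ∧, ∨

data PF : Set where
  pv   : ℕ → PF
  pneg : PF → PF
  pand : PF → PF → PF
  por  : PF → PF → PF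

evalPF : (ℕ → Bool) → PF → Bool
evalPF ρ (pv i)     = ρ i
evalPF ρ (pneg φ)   = not (evalPF ρ φ)
evalPF ρ (pand φ ψ) = evalPF ρ φ ∧ evalPF ρ ψ
evalPF ρ (por φ ψ)  = evalPF ρ φ ∨ evalPF ρ ψ

Tautology : PF → Set
Tautology φ = ∀ ρ → evalPF ρ φ ≡ true

substPF : (ℕ → For) → PF → For
substPF σ (pv i)     = σ i
substPF σ (pneg φ)   = ¬' substPF σ φ
substPF σ (pand φ ψ) = substPF σ φ ∧' substPF σ ψ
substPF σ (por φ ψ)  = substPF σ φ ∨' substPF σ ψ

data Axiom : For → Set where
  cpl   : ∀ φ σ → Tautology φ → Axiom (substPF σ φ)
  ax1   : ∀ A → Axiom (¬' (A ⇒ ¬' A))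
  ax2   : ∀ A → Axiom (¬' ((¬' A) ⇒ A))
  ax3   : ∀ A B → Axiom ((A ⇒ B) ⇒ ¬' (A ⇒ ¬' B))
  ax4   : ∀ A B → Axiom ((A ⇒ ¬' B) ⇒ ¬' (A ⇒ B))
  ax5   : ∀ A B → Axiom ((A ⇒ B) ⊃ (A ⊃ B))
  dual  : ∀ A → Axiom ((◇ A) ≣ (¬' (□ (¬' A))))
  kax   : ∀ A B → Axiom ((□ (A ⊃ B)) ⊃ ((□ A) ⊃ (□ B)))
  cudl  : ∀ A B → Axiom ((d A ⇒ d B) ⊃ ((A ⇒ B) ∨' (A ∧' ¬' B)))

data Thm : For → Set where
  axiom : ∀ {A} → Axiom A → Thm A
  mp    : ∀ {A B} → Thm A → Thm (A ⊃ B) → Thm B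
  nec   : ∀ {A} → Thm A → Thm (□ A)

data _⊢_ (Γ : For → Set) : For → Set where
  thm : ∀ {A} → Thm A → Γ ⊢ A
  hyp : ∀ {A} → Γ A → Γ ⊢ A
  mp  : ∀ {A B} → Γ ⊢ A → Γ ⊢ (A ⊃ B) → Γ ⊢ B

-- Soundness: every axiom is true at every world of every model on an F^dL
-- frame, and truth at a world is preserved by modus ponens; necessitation
-- is sound because theorems hold at all worlds, not just at the current one.
-- The connexive axioms are exactly the conditions (a1), (a2), (b0)–(b2) on
-- R_w, and (CUDL) is (demL).  The metatheory is classical: excluded middle
-- is needed to read ⊃ as material implication and for tautologies.
module Submission where

open import Defs
open import Level using (zero)
open import Axiom.ExcludedMiddle using (ExcludedMiddle)
open import Data.Nat using (ℕ)
open import Data.Product using (_,_; proj₁; proj₂)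
open import Data.Sum using (_⊎_; inj₁; inj₂)
open import Relation.Nullary using (¬_; yes; no; does; proof; contradiction)
open import Relation.Nullary.Decidable using (decidable-stable)
open import Relation.Nullary.Reflects
  using (Reflects; invert; ¬-reflects; _×-reflects_; _⊎-reflects_)
open import Relation.Binary.PropositionalEquality using (subst)

⊃-elim : ∀ {M w A B} → Sat M w (A ⊃ B) → Sat M w A → Sat M w B
⊃-elim (inj₁ ¬a) a = contradiction a ¬a
⊃-elim (inj₂ b)  _ = b

module Classical (em : ExcludedMiddle zero) where

  stable : {P : Set} → ¬ ¬ P → P
  stable = decidable-stable em

  material : {P Q : Set} → (P → Q) → ¬ P ⊎ Q
  material {P} f with em {P}
  ... | yes p = inj₂ (f p)
  ... | no ¬p = inj₁ ¬p

  module _ (M : Model) (w : Model.W M) (σ : ℕ → For) where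

    substPF-reflects : ∀ φ →
      Reflects (Sat M w (substPF σ φ)) (evalPF (λ i → does (em {Sat M w (σ i)})) φ)
    substPF-reflects (pv i)     = proof em
    substPF-reflects (pneg φ)   = ¬-reflects (substPF-reflects φ)
    substPF-reflects (pand φ ψ) = substPF-reflects φ ×-reflects substPF-reflects ψ
    substPF-reflects (por φ ψ)  = substPF-reflects φ ⊎-reflects substPF-reflects ψ

    tautology-instance-true : ∀ φ → Tautology φ → Sat M w (substPF σ φ)
    tautology-instance-true φ taut =
      invert (subst (Reflects _) (taut _) (substPF-reflects φ))

module Soundness (em : ExcludedMiddle zero) (M : Model) (F : InFdL (Model.frame M)) where
  open Model M
  open Classical em
  open module Cond {w} = Conditions (F w)

  axiom-true : ∀ {A} → Axiom A → ∀ w → Sat M w A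
  axiom-true (cpl φ σ taut) w = tautology-instance-true M w σ φ taut
  axiom-true (ax1 A)   w (_ , r) = a1 A r
  axiom-true (ax2 A)   w (_ , r) = a2 A r
  axiom-true (ax3 A B) w = material (λ s t → b0 A B (proj₂ s) (proj₂ t)) , b1 A B
  axiom-true (ax4 A B) w = material (λ s t → b0 A B (proj₂ t) (proj₂ s)) , b2 A B
  axiom-true (ax5 A B) w = material λ s → material (⊃-elim (proj₁ s))
  axiom-true (dual A)  w =
      material (λ { (u , q , a) □¬a → □¬a u q a })
    , material (λ ¬□¬a → stable λ ¬◇a → ¬□¬a λ u q a → ¬◇a (u , q , a))
  axiom-true (kax A B) w = material λ □a⊃b → material λ □a u q → ⊃-elim (□a⊃b u q) (□a u q)
  axiom-true (cudl A B) w = material λ (_ , r) → ⇒-or-counterexample (demL A B r)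
    where
    ⇒-or-counterexample : R w A B → Sat M w ((A ⇒ B) ∨' (A ∧' ¬' B))
    ⇒-or-counterexample r with em {Sat M w (A ∧' ¬' B)}
    ... | yes a∧¬b = inj₂ a∧¬b
    ... | no ¬a∧¬b = inj₁ (material (λ a → stable λ ¬b → ¬a∧¬b (a , ¬b)) , r)

  theorem-true : ∀ {A} → Thm A → ∀ w → Sat M w A
  theorem-true (axiom ax) w  = axiom-true ax w
  theorem-true (mp a a⊃b) w  = ⊃-elim (theorem-true a⊃b w) (theorem-true a w)
  theorem-true (nec a) w u _ = theorem-true a u

  derivable-true : ∀ {Γ A} → Γ ⊢ A → ∀ w → (∀ B → Γ B → Sat M w B) → Sat M w A
  derivable-true (thm t)    w Γ-true = theorem-true t w
  derivable-true (hyp γ)    w Γ-true = Γ-true _ γ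
  derivable-true (mp a a⊃b) w Γ-true =
    ⊃-elim (derivable-true a⊃b w Γ-true) (derivable-true a w Γ-true)

mainTheorem10 : ExcludedMiddle zero →
    (Γ : For → Set) (A : For) → Γ ⊢ A → Γ ⊨dL A
mainTheorem10 em Γ A ⊢A M F = Soundness.derivable-true em M F ⊢A
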